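{- Let $f:\{0,1\}^n\to\{0,1\}$ be a Boolean function and let $g:\{0,1,*\}^n\to\mathbb{Z}_{\ge 0}$ be a goal function for $f$. Then $g$ is a goal function for exactly one Boolean function on $\{0,1\}^n$ other than $f$, namely $\neg f$.
   Context: A partial assignment is a vector $b\in\{0,1,*\}^n$. For partial assignments $a,b$, we write $a\succeq b$ ($a$ extends $b$) if $a_i=b_i$ for every $i$ with $b_i\neq *$. For $f:\{0,1\}^n\to\{0,1\}$, a partial assignment $b$ is a $0$-certificate (resp. $1$-certificate) of $f$ if $f(a)=0$ (resp. $f(a)=1$) for all $a\in\{0,1\}^n$ with $a\succeq b$; it is a certificate if it is a $0$- or $1$-certificate. A partial assignment $b$ contains a certificate if $b\succeq c$ for some certificate $c$. For $b$ with $b_i=*$ and $\ell\in\{0,1\}$, $b_{x_i\leftarrow\ell}$ denotes $b$ with its $i$-th coordinate changed to $\ell$. A function $g:\{0,1,*\}^n\to\mathbb{Z}_{\ge0}$ is monotone if $g(b_{x_i\leftarrow\ell})\ge g(b)$ whenever $b_i=*$ and $\ell\in\{0,1\}$; it is submodular if $g(b_{x_i\leftarrow\ell})-g(b)\ge g(b'_{x_i\leftarrow\ell})-g(b')$ whenever $b'\succeq b$, $b_i=b'_i=*$ and $\ell\in\{0,1\}$. A goal function for $f$ is a monotone submodular $g:\{0,1,*\}^n\to\mathbb{Z}_{\ge0}$ such that, for some integer $Q\ge 0$ (its goal value), $g(b)=Q$ for all $b\in\{0,1\}^n$, and for every partial assignment $b$, $g(b)=Q$ if and only if $b$ contains a certificate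 of $f$. -}

module Defs where

open import Data.Nat using (ℕ; _≤_; _+_)
open import Data.Bool using (Bool; not)
open import Data.Maybe using (Maybe; just; nothing)
open import Data.Fin using (Fin; _≟_)
open import Data.Product using (Σ; ∃; _×_)
open import Data.Sum using (_⊎_)
open import Relation.Binary.PropositionalEquality using (_≡_)
open import Relation.Nullary using (yes; no)
open import Function using (_∘_; _⇔_)

-- A partial assignment: each coordinate is just 0/1 (false/true) or nothing (= *).
PartialAssignment : ℕ → Set
PartialAssignment n = Fin n → Maybe Bool

Assignment : ℕ → Set
Assignment n = Fin n → Bool

BoolFun : ℕ → Set
BoolFun n = Assignment n → Bool

total : ∀ {n} → Assignment n → PartialAssignment n
total a = just ∘ a

_⪰_ : ∀ {n} → PartialAssignment n → PartialAssignment n → Set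
_⪰_ {n} a b = ∀ (i : Fin n) (v : Bool) → b i ≡ just v → a i ≡ just v

set : ∀ {n} → PartialAssignment n → Fin n → Bool → PartialAssignment n
set b i ℓ j with j ≟ i
... | yes _ = just ℓ
... | no _  = b j

IsCertificateFor : ∀ {n} → BoolFun n → Bool → PartialAssignment n → Set
IsCertificateFor {n} f ℓ b = ∀ (a : Assignment n) → total a ⪰ b → f a ≡ ℓ

IsCertificate : ∀ {n} → BoolFun n → PartialAssignment n → Set
IsCertificate f b = Σ Bool λ ℓ → IsCertificateFor f ℓ b

ContainsCertificate : ∀ {n} → BoolFun n → PartialAssignment n → Set
ContainsCertificate {n} f b = Σ (PartialAssignment n) λ c → (b ⪰ c) × IsCertificate f c

Monotone : ∀ {n} → (PartialAssignment n → ℕ) → Set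
Monotone {n} g = ∀ (b : PartialAssignment n) (i : Fin n) (ℓ : Bool) →
  b i ≡ nothing → g b ≤ g (set b i ℓ)

-- g(b_{i←ℓ}) - g(b) ≥ g(b'_{i←ℓ}) - g(b'), rearranged to avoid truncated subtraction.
Submodular : ∀ {n} → (PartialAssignment n → ℕ) → Set
Submodular {n} g = ∀ (b b' : PartialAssignment n) (i : Fin n) (ℓ : Bool) →
  b' ⪰ b → b i ≡ nothing → b' i ≡ nothing →
  g (set b' i ℓ) + g b ≤ g (set b i ℓ) + g b'

IsGoalFunction : ∀ {n} → (PartialAssignment n → ℕ) → BoolFun n → Set
IsGoalFunction {n} g f =
  Monotone g × Submodular g ×
  Σ ℕ λ Q →
    (∀ (a : Assignment n) → g (total a) ≡ Q) ×
    (∀ (b : PartialAssignment n) → (g b ≡ Q) ⇔ ContainsCertificate f b)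

-- The level set {g = Q} of a goal function is exactly the set of partial assignments
-- containing a certificate, so any two functions with goal function g have the same such
-- sets. Freeing one coordinate of a total assignment yields a partial assignment containing
-- a certificate exactly when the function is constant along that edge of the cube. Hence f
-- and h change value along the same edges, so f xor h is constant on the connected cube:
-- h = f or h = not f. Conversely f and not f have the same certificates.
module Submission where

open import Defs
open import Data.Nat using (ℕ)
open import Data.Bool using (Bool; true; false; not; _xor_)
open import Data.Bool.Properties
  using (not-involutive; not-¬; ¬-not; xor-assoc; xor-same; xor-comm; xor-identityʳ; true-xor)
open import Data.Maybe using (just; nothing)
open import Data.Maybe.Properties using (just-injective)
open import Data.Fin using (Fin; _≟_)
open import Data.List using (List; []; _∷_; allFin)
open import Data.List.Relation.Unary.Any using (here; there)
open import Data.List.Membership.Propositional using (_∉_)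
open import Data.List.Membership.Propositional.Properties using (∈-allFin)
open import Data.Vec.Functional using (updateAt)
open import Data.Vec.Functional.Properties using (updateAt-updates; updateAt-minimal; updateAt-id-local)
open import Data.Product using (_×_; _,_)
open import Data.Sum using (_⊎_; inj₁; inj₂)
open import Function using (_∘_; id; const; _⇔_; mk⇔; Equivalence)
open import Relation.Binary.PropositionalEquality
open import Relation.Nullary using (¬_; yes; no; contradiction)

private
  variable
    n : ℕ

_[_]≔_ : Assignment n → Fin n → Bool → Assignment n
x [ i ]≔ v = updateAt x i (const v)

release : Assignment n → Fin n → PartialAssignment n
release x i = updateAt (total x) i (const nothing)

⪰-trans : {a b c : PartialAssignment n} → a ⪰ b → b ⪰ c → a ⪰ c
⪰-trans a⪰b b⪰c i v = a⪰b i v ∘ b⪰c i v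

≗⇒total-⪰ : {x y : Assignment n} → x ≗ y → total y ⪰ total x
≗⇒total-⪰ x≗y i v x≡v = trans (cong just (sym (x≗y i))) x≡v

[]≔-⪰-release : (x : Assignment n) (i : Fin n) (v : Bool) → total (x [ i ]≔ v) ⪰ release x i
[]≔-⪰-release x i v j w with j ≟ i
... | yes refl = λ nothing≡just → contradiction (trans (sym (updateAt-updates i (total x))) nothing≡just) λ ()
... | no j≢i = λ release≡w →
  trans (cong just (updateAt-minimal j i x j≢i)) (trans (sym (updateAt-minimal j i (total x) j≢i)) release≡w)

⪰-release⇒≗[]≔ : (x a : Assignment n) (i : Fin n) → total a ⪰ release x i → a ≗ x [ i ]≔ a i
⪰-release⇒≗[]≔ x a i a⪰ j with j ≟ i
... | yes refl = sym (updateAt-updates i x)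
... | no j≢i = trans (just-injective (a⪰ j (x j) (updateAt-minimal j i (total x) j≢i)))
                     (sym (updateAt-minimal j i x j≢i))

containsCertificate⇒constant : {f : BoolFun n} {b : PartialAssignment n} {a a′ : Assignment n} →
  ContainsCertificate f b → total a ⪰ b → total a′ ⪰ b → f a ≡ f a′
containsCertificate⇒constant (c , b⪰c , ℓ , cert) a⪰b a′⪰b =
  trans (cert _ (⪰-trans a⪰b b⪰c)) (sym (cert _ (⪰-trans a′⪰b b⪰c)))

-- Without function extensionality this is not automatic: it holds because every total
-- assignment contains a certificate.
goalFunction⇒respects-≗ : {g : PartialAssignment n → ℕ} {f : BoolFun n} →
  IsGoalFunction g f → {x y : Assignment n} → x ≗ y → f x ≡ f y
goalFunction⇒respects-≗ (_ , _ , _ , total≡Q , level) {x} x≗y =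
  containsCertificate⇒constant (Equivalence.to (level (total x)) (total≡Q x)) (λ _ _ → id) (≗⇒total-⪰ x≗y)

release-containsCertificate⇔ : {f : BoolFun n} → (∀ {x y} → x ≗ y → f x ≡ f y) →
  (x : Assignment n) (i : Fin n) →
  ContainsCertificate f (release x i) ⇔ f (x [ i ]≔ false) ≡ f (x [ i ]≔ true)
release-containsCertificate⇔ {f = f} f-respects-≗ x i = mk⇔
  (λ cc → containsCertificate⇒constant cc ([]≔-⪰-release x i false) ([]≔-⪰-release x i true))
  (λ flat → release x i , (λ _ _ → id) , f (x [ i ]≔ false) , certificate flat)
  where
  certificate : f (x [ i ]≔ false) ≡ f (x [ i ]≔ true) →
    IsCertificateFor f (f (x [ i ]≔ false)) (release x i)
  certificate flat a a⪰ with a i | f-respects-≗ (⪰-release⇒≗[]≔ x a i a⪰)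
  ... | false | fa≡ = fa≡
  ... | true  | fa≡ = trans fa≡ (sym flat)

goalFunctions-shareCertificates : {g : PartialAssignment n → ℕ} {f h : BoolFun n} →
  IsGoalFunction g f → IsGoalFunction g h →
  (b : PartialAssignment n) → ContainsCertificate f b → ContainsCertificate h b
goalFunctions-shareCertificates (_ , _ , Qf , f-total , f-level) (_ , _ , Qh , h-total , h-level) b cc =
  Equivalence.to (h-level b) (trans (Equivalence.from (f-level b) cc) same-goal)
  where
  same-goal : Qf ≡ Qh
  same-goal = trans (sym (f-total (const false))) (h-total (const false))

xor-cong-⇔ : ∀ a b c d → (a ≡ b ⇔ c ≡ d) → a xor c ≡ b xor d
xor-cong-⇔ false false c d a≡b⇔c≡d = Equivalence.to a≡b⇔c≡d refl
xor-cong-⇔ true  true  c d a≡b⇔c≡d = cong not (Equivalence.to a≡b⇔c≡d refl)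
xor-cong-⇔ false true  c d a≡b⇔c≡d =
  ¬-not λ c≡d → contradiction (Equivalence.from a≡b⇔c≡d c≡d) λ ()
xor-cong-⇔ true  false c d a≡b⇔c≡d =
  sym (¬-not λ d≡c → contradiction (Equivalence.from a≡b⇔c≡d (sym d≡c)) λ ())

xor-cancelˡ : ∀ a b → a xor (a xor b) ≡ b
xor-cancelˡ a b = trans (sym (xor-assoc a a b)) (cong (_xor b) (xor-same a))

module _ {A : Set} (P : Assignment n → A) (P-respects-≗ : ∀ {x y} → x ≗ y → P x ≡ P y)
  (P-flat : ∀ x i → P (x [ i ]≔ false) ≡ P (x [ i ]≔ true)) where

  flat-[]≔ : ∀ x i v → P (x [ i ]≔ v) ≡ P x
  flat-[]≔ x i v = trans (flat-any v (x i)) (P-respects-≗ (updateAt-id-local i x refl))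
    where
    flat-any : ∀ v w → P (x [ i ]≔ v) ≡ P (x [ i ]≔ w)
    flat-any false false = refl
    flat-any false true  = P-flat x i
    flat-any true  false = sym (P-flat x i)
    flat-any true  true  = refl

  flat-agreeOutside : (L : List (Fin n)) → ∀ x y → (∀ j → j ∉ L → x j ≡ y j) → P x ≡ P y
  flat-agreeOutside [] x y agree = P-respects-≗ λ j → agree j λ ()
  flat-agreeOutside (i ∷ L) x y agree =
    trans (sym (flat-[]≔ x i (y i))) (flat-agreeOutside L (x [ i ]≔ y i) y agree′)
    where
    agree′ : ∀ j → j ∉ L → (x [ i ]≔ y i) j ≡ y j
    agree′ j j∉L with j ≟ i
    ... | yes refl = updateAt-updates i x
    ... | no j≢i = trans (updateAt-minimal j i x j≢i)
                         (agree j λ { (here j≡i) → j≢i j≡i ; (there j∈L) → j∉L j∈L })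

  flat⇒constant : ∀ x y → P x ≡ P y
  flat⇒constant x y = flat-agreeOutside (allFin _) x y λ j j∉ → contradiction (∈-allFin j) j∉

containsCertificate-not : {f : BoolFun n} {b : PartialAssignment n} →
  ContainsCertificate f b → ContainsCertificate (not ∘ f) b
containsCertificate-not (c , b⪰c , ℓ , cert) = c , b⪰c , not ℓ , λ a a⪰c → cong not (cert a a⪰c)

containsCertificate-not⁻ : {f : BoolFun n} {b : PartialAssignment n} →
  ContainsCertificate (not ∘ f) b → ContainsCertificate f b
containsCertificate-not⁻ {f = f} cc with containsCertificate-not cc
... | c , b⪰c , ℓ , cert = c , b⪰c , ℓ , λ a a⪰c → trans (sym (not-involutive (f a))) (cert a a⪰c)

goalFunction-not : {g : PartialAssignment n → ℕ} {f : BoolFun n} →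
  IsGoalFunction g f → IsGoalFunction g (not ∘ f)
goalFunction-not (mono , submod , Q , total≡Q , level) = mono , submod , Q , total≡Q , λ b → mk⇔
  (containsCertificate-not ∘ Equivalence.to (level b))
  (Equivalence.from (level b) ∘ containsCertificate-not⁻)

goalFunctions-shareFlatEdges : {g : PartialAssignment n → ℕ} {f h : BoolFun n} →
  IsGoalFunction g f → IsGoalFunction g h → ∀ x i →
  f (x [ i ]≔ false) ≡ f (x [ i ]≔ true) → h (x [ i ]≔ false) ≡ h (x [ i ]≔ true)
goalFunctions-shareFlatEdges Gf Gh x i =
  Equivalence.to (release-containsCertificate⇔ (goalFunction⇒respects-≗ Gh) x i)
  ∘ goalFunctions-shareCertificates Gf Gh (release x i)
  ∘ Equivalence.from (release-containsCertificate⇔ (goalFunction⇒respects-≗ Gf) x i)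

goalFunctions-xor-constant : {g : PartialAssignment n → ℕ} {f h : BoolFun n} →
  IsGoalFunction g f → IsGoalFunction g h → ∀ x y → f x xor h x ≡ f y xor h y
goalFunctions-xor-constant {f = f} {h} Gf Gh = flat⇒constant (λ x → f x xor h x)
  (λ x≗y → cong₂ _xor_ (goalFunction⇒respects-≗ Gf x≗y) (goalFunction⇒respects-≗ Gh x≗y))
  (λ x i → xor-cong-⇔ _ _ _ _
    (mk⇔ (goalFunctions-shareFlatEdges Gf Gh x i) (goalFunctions-shareFlatEdges Gh Gf x i)))

theorem1 : ∀ (n : ℕ) (f : BoolFun n) (g : PartialAssignment n → ℕ) →
    IsGoalFunction g f →
    (¬ (∀ (x : Assignment n) → not (f x) ≡ f x)) ×
    IsGoalFunction g (λ x → not (f x)) ×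
    (∀ (h : BoolFun n) → IsGoalFunction g h →
      (∀ (x : Assignment n) → h x ≡ f x) ⊎ (∀ (x : Assignment n) → h x ≡ not (f x)))
theorem1 n f g Gf =
  (λ not-f≡f → not-¬ refl (sym (not-f≡f (const false)))) ,
  goalFunction-not Gf ,
  λ h Gh → by-offset h (f 0ⁿ xor h 0ⁿ) λ x → begin
    h x                       ≡⟨ xor-cancelˡ (f x) (h x) ⟨
    f x xor (f x xor h x)     ≡⟨ cong (f x xor_) (goalFunctions-xor-constant Gf Gh x 0ⁿ) ⟩
    f x xor (f 0ⁿ xor h 0ⁿ)   ∎
  where
  open ≡-Reasoning
  0ⁿ : Assignment n
  0ⁿ = const false

  by-offset : (h : BoolFun n) (c : Bool) → (∀ x → h x ≡ f x xor c) →
    (∀ x → h x ≡ f x) ⊎ (∀ x → h x ≡ not (f x))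
  by-offset h false h≡ = inj₁ λ x → trans (h≡ x) (xor-identityʳ (f x))
  by-offset h true  h≡ = inj₂ λ x → trans (h≡ x) (trans (xor-comm (f x) true) (true-xor (f x)))
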